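{- Let $M_1,M_2,N_1,N_2\models T_{\mathrm{base}}$. If $M_1\equiv N_1$ and $M_2\equiv N_2$, then $M_1\oplus M_2\equiv N_1\oplus N_2$.
   Context: Let $\mathcal{L}=\{\subseteq,\bot,\mathrm{At},\lhd\}$ be the first-order language with binary relation symbols $\subseteq,\lhd$, a constant $\bot$ and a unary relation symbol $\mathrm{At}$. Lowercase variables range over atoms; $X(x)$ abbreviates $x\subseteq X$. $T_{\mathrm{base}}$ states: $\subseteq$ is an atomic Boolean algebra order (one-element algebra allowed); $\lhd$ linearly orders the atoms; $\bot$ is least; $\mathrm{At}$ holds exactly of atoms; $\forall X\forall Y(X\lhd Y\leftrightarrow\exists x\exists y(X(x)\wedge Y(y)\wedge x\lhd y))$; and for every $\mathcal{L}$-formula $\eta(x;\bar Y)$, $\forall\bar Y\exists X\forall x(X(x)\leftrightarrow\eta(x;\bar Y))$. For $M,N\models T_{\mathrm{base}}$, $M\oplus N$ is the $\mathcal{L}$-structure with universe $|M|\times|N|$, $\subseteq$ componentwise, $\bot$ and $\mathrm{At}$ the bottom and atoms of the product Boolean algebra, and $(A,B)\lhd(C,D)$ iff ($A\neq\bot$ in $M$ and $D\neq\bot$ in $N$) or $M\models A\lhd C$ or $N\models B\lhd D$. $\equiv$ denotes elementary equivalence of $\mathcal{L}$-structures. -}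

module Defs where

open import Data.Nat using (ℕ; suc)
open import Data.Fin using (Fin; zero; suc)
open import Data.Product using (Σ; ∃; _×_; _,_)
open import Data.Sum using (_⊎_)
open import Data.Empty using (⊥)
open import Data.Unit using (⊤)
open import Relation.Nullary using (¬_)
open import Relation.Binary.PropositionalEquality using (_≡_)

data Term (n : ℕ) : Set where
  var  : Fin n → Term n
  bot  : Term n

data Formula (n : ℕ) : Set where
  _≐_   : Term n → Term n → Formula n
  _⊑_   : Term n → Term n → Formula n
  _◃_   : Term n → Term n → Formula n
  at    : Term n → Formula n
  falsum : Formula n
  _⇒_   : Formula n → Formula n → Formula n
  _∧_   : Formula n → Formula n → Formula n
  _∨_   : Formula n → Formula n → Formula n
  ¬'_   : Formula n → Formula n
  all   : Formula (suc n) → Formula n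
  ex    : Formula (suc n) → Formula n

Sentence : Set
Sentence = Formula 0

record Structure : Set₁ where
  field
    Carrier : Set
    _⊆_     : Carrier → Carrier → Set
    ⊥ₛ      : Carrier
    At      : Carrier → Set
    _◁_     : Carrier → Carrier → Set

_↔_ : Set → Set → Set
A ↔ B = (A → B) × (B → A)

extend : ∀ {n} {A : Set} → A → (Fin n → A) → Fin (suc n) → A
extend a ρ zero    = a
extend a ρ (suc i) = ρ i

module _ (M : Structure) where
  open Structure M

  evalT : ∀ {n} → (Fin n → Carrier) → Term n → Carrier
  evalT ρ (var i) = ρ i
  evalT ρ bot     = ⊥ₛ

  Sat : ∀ {n} → Formula n → (Fin n → Carrier) → Set
  Sat (s ≐ t) ρ = evalT ρ s ≡ evalT ρ t
  Sat (s ⊑ t) ρ = evalT ρ s ⊆ evalT ρ t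
  Sat (s ◃ t) ρ = evalT ρ s ◁ evalT ρ t
  Sat (at t)  ρ = At (evalT ρ t)
  Sat falsum  ρ = ⊥
  Sat (φ ⇒ ψ) ρ = Sat φ ρ → Sat ψ ρ
  Sat (φ ∧ ψ) ρ = Sat φ ρ × Sat ψ ρ
  Sat (φ ∨ ψ) ρ = Sat φ ρ ⊎ Sat ψ ρ
  Sat (¬' φ)  ρ = ¬ Sat φ ρ
  Sat (all φ) ρ = (a : Carrier) → Sat φ (extend a ρ)
  Sat (ex φ)  ρ = Σ Carrier λ a → Sat φ (extend a ρ)

noVars : {A : Set} → Fin 0 → A
noVars ()

_⊨_ : Structure → Sentence → Set
M ⊨ φ = Sat M φ noVars

_≡ₑ_ : Structure → Structure → Set
M ≡ₑ N = (φ : Sentence) → (M ⊨ φ) ↔ (N ⊨ φ)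

module Order {C : Set} (_≤_ : C → C → Set) where
  IsMeet : C → C → C → Set
  IsMeet a b m = (m ≤ a) × (m ≤ b) × ((c : C) → c ≤ a → c ≤ b → c ≤ m)

  IsJoin : C → C → C → Set
  IsJoin a b j = (a ≤ j) × (b ≤ j) × ((c : C) → a ≤ c → b ≤ c → j ≤ c)

  IsAtom : C → C → Set
  IsAtom z a = ¬ (a ≡ z) × ((b : C) → b ≤ a → (b ≡ z) ⊎ (b ≡ a))

  -- _≤_ is the order of an atomic Boolean algebra with least element z
  -- (the one-element algebra is allowed)
  record IsAtomicBAOrder (z : C) : Set where
    field
      refl≤    : (a : C) → a ≤ a
      antisym  : (a b : C) → a ≤ b → b ≤ a → a ≡ b
      trans≤   : (a b c : C) → a ≤ b → b ≤ c → a ≤ c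
      least    : (a : C) → z ≤ a
      top      : Σ C λ t → (a : C) → a ≤ t
      meets    : (a b : C) → Σ C (IsMeet a b)
      joins    : (a b : C) → Σ C (IsJoin a b)
      distrib  : (a b c j m p q r : C) → IsJoin b c j → IsMeet a j m →
                 IsMeet a b p → IsMeet a c q → IsJoin p q r → m ≡ r
      compl    : (a : C) → Σ C λ b → IsMeet a b z ×
                   ((t : C) → ((x : C) → x ≤ t) → IsJoin a b t)
      atomic   : (a : C) → ¬ (a ≡ z) → Σ C λ x → IsAtom z x × (x ≤ a)

record IsBase (M : Structure) : Set where
  open Structure M
  open Order _⊆_
  field
    ba        : IsAtomicBAOrder ⊥ₛ
    at-atoms  : (a : Carrier) → At a ↔ IsAtom ⊥ₛ a
    ◁-irrefl  : (x : Carrier) → At x → ¬ (x ◁ x)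
    ◁-trans   : (x y w : Carrier) → At x → At y → At w → x ◁ y → y ◁ w → x ◁ w
    ◁-total   : (x y : Carrier) → At x → At y → (x ◁ y) ⊎ (x ≡ y) ⊎ (y ◁ x)
    ◁-ext     : (X Y : Carrier) → (X ◁ Y) ↔
                  (Σ Carrier λ x → Σ Carrier λ y →
                     At x × At y × (x ⊆ X) × (y ⊆ Y) × (x ◁ y))
    compr     : {k : ℕ} (η : Formula (suc k)) (Ys : Fin k → Carrier) →
                Σ Carrier λ X → (x : Carrier) → At x →
                  (x ⊆ X) ↔ Sat M η (extend x Ys)

_⊕_ : Structure → Structure → Structure
M ⊕ N = record
  { Carrier = M.Carrier × N.Carrier
  ; _⊆_     = _≤_
  ; ⊥ₛ      = (M.⊥ₛ , N.⊥ₛ)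
  ; At      = Order.IsAtom _≤_ (M.⊥ₛ , N.⊥ₛ)
  ; _◁_     = _◁⊕_
  }
  where
    module M = Structure M
    module N = Structure N
    _≤_ : M.Carrier × N.Carrier → M.Carrier × N.Carrier → Set
    (A , B) ≤ (C , D) = M._⊆_ A C × N._⊆_ B D
    _◁⊕_ : M.Carrier × N.Carrier → M.Carrier × N.Carrier → Set
    (A , B) ◁⊕ (C , D) = (¬ (A ≡ M.⊥ₛ) × ¬ (D ≡ N.⊥ₛ)) ⊎ M._◁_ A C ⊎ N._◁_ B D

-- Feferman–Vaught. Over M ⊕ N, with the environment split into its two
-- components, every formula is equivalent to a finite disjunction of
-- conjunctions ψᵢ(M) ∧ χᵢ(N), where the pairs (ψᵢ , χᵢ) depend only on the
-- formula. Atomic formulas decompose because =, ⊆ and ◁ on the sum are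
-- componentwise and an atom of the sum is an atom of one summand paired with
-- ⊥ of the other; such disjunctions are closed (classically) under the
-- connectives and under ∃, which splits into one quantifier per summand.
-- For a sentence all ψᵢ and χᵢ are sentences, so elementary equivalence of
-- the summands preserves the truth of the decomposition.
module Submission where

open import Defs
open import Level using (0ℓ)
open import Axiom.ExcludedMiddle using (ExcludedMiddle)
open import Axiom.DoubleNegationElimination using (em⇒dne)
open import Data.Nat using (ℕ; suc)
open import Data.Fin using (Fin; zero; suc)
open import Data.Product using (Σ; _×_; _,_; proj₁; proj₂; <_,_>; uncurry)
open import Data.Product.Properties using (×-≡,≡→≡; ×-≡,≡←≡)
open import Data.Product.Relation.Binary.Pointwise.NonDependent using (Pointwise)
open import Data.Product.Function.NonDependent.Propositional using (_×-⇔_)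
import Data.Product.Function.Dependent.Propositional as Σ
open import Data.Sum using (_⊎_; inj₁; inj₂; [_,_]′)
open import Data.Sum.Function.Propositional using (_⊎-⇔_)
open import Data.Empty using (⊥)
open import Data.List using (List; []; _∷_; [_]; _++_; map; cartesianProductWith)
open import Data.List.Relation.Unary.Any using (Any; here)
import Data.List.Relation.Unary.Any as Any
open import Data.List.Relation.Unary.Any.Properties
  using (++↔; ∷↔; singleton⁺; singleton⁻; map⁺; map⁻; Any-Σ⁺ʳ; Any-Σ⁻ʳ;
         cartesianProductWith⁺; cartesianProductWith⁻)
open import Function using (_∘_)
open import Function.Bundles using (_⇔_; mk⇔; Equivalence)
open import Function.Properties.Equivalence using (⇔-setoid)
open import Function.Properties.Inverse using (↔⇒⇔)
open import Function.Construct.Symmetry using (⇔-sym)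
open import Function.Construct.Composition using (_⇔-∘_)
open import Function.Construct.Identity using (⇔-id)
open import Function.Related.TypeIsomorphisms using (→-cong-⇔; ¬-cong-⇔)
open import Relation.Nullary using (¬_; yes; no)
open import Relation.Nullary.Negation using (contradiction; _¬-⊎_)
open import Relation.Binary.PropositionalEquality
  using (_≡_; _≗_; refl; sym; cong; cong₂)
import Relation.Binary.Reasoning.Setoid as SetoidReasoning

open Equivalence using (to; from)
open SetoidReasoning (⇔-setoid 0ℓ)

private
  variable
    n : ℕ
    A B : Set

fromIff : A ↔ B → A ⇔ B
fromIff (f , g) = mk⇔ f g

toIff : A ⇔ B → A ↔ B
toIff e = to e , from e

≡⇒⇔ : A ≡ B → A ⇔ B
≡⇒⇔ refl = mk⇔ (λ a → a) (λ a → a)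

Π-cong-⇔ : {P Q : A → Set} → (∀ x → P x ⇔ Q x) → ((x : A) → P x) ⇔ ((x : A) → Q x)
Π-cong-⇔ e = mk⇔ (λ f x → to (e x) (f x)) (λ g x → from (e x) (g x))

×-¬⊥ʳ : (A × ¬ ⊥) ⇔ A
×-¬⊥ʳ = mk⇔ proj₁ (_, λ ())

×-¬⊥ˡ : (¬ ⊥ × A) ⇔ A
×-¬⊥ˡ = mk⇔ proj₂ ((λ ()) ,_)

¬⊎⇔¬×¬ : (¬ (A ⊎ B)) ⇔ (¬ A × ¬ B)
¬⊎⇔¬×¬ = mk⇔ (λ f → f ∘ inj₁ , f ∘ inj₂) (uncurry _¬-⊎_)

Σ×Σ⇔Σ× : {P : A → Set} {Q : B → Set} →
          (Σ A P × Σ B Q) ⇔ Σ (A × B) (λ (a , b) → P a × Q b)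
Σ×Σ⇔Σ× = mk⇔ (λ ((a , p) , (b , q)) → (a , b) , (p , q)) (λ ((a , b) , (p , q)) → (a , p) , (b , q))

module Classical (em : ExcludedMiddle 0ℓ) where

  ¬×⇔¬⊎¬ : (¬ (A × B)) ⇔ (¬ A ⊎ ¬ B)
  ¬×⇔¬⊎¬ {A} {B} = mk⇔ split [ (λ ¬a (a , _) → ¬a a) , (λ ¬b (_ , b) → ¬b b) ]′
    where
      split : ¬ (A × B) → ¬ A ⊎ ¬ B
      split ¬ab with em {A}
      ... | yes a = inj₂ (λ b → ¬ab (a , b))
      ... | no ¬a = inj₁ ¬a

  →⇔¬⊎ : (A → B) ⇔ (¬ A ⊎ B)
  →⇔¬⊎ {A} {B} = mk⇔ split [ (λ ¬a a → contradiction a ¬a) , (λ b _ → b) ]′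
    where
      split : (A → B) → ¬ A ⊎ B
      split f with em {A}
      ... | yes a = inj₂ (f a)
      ... | no ¬a = inj₁ ¬a

  Π⇔¬Σ¬ : {P : A → Set} → ((x : A) → P x) ⇔ (¬ Σ A (¬_ ∘ P))
  Π⇔¬Σ¬ = mk⇔ (λ f (x , ¬p) → ¬p (f x)) (λ ¬σ x → em⇒dne em (λ ¬p → ¬σ (x , ¬p)))

module _ {A B : Set} {_≤₁_ : A → A → Set} {_≤₂_ : B → B → Set} {z₁ : A} {z₂ : B}
         (em : ExcludedMiddle 0ℓ)
         (ba₁ : Order.IsAtomicBAOrder _≤₁_ z₁) (ba₂ : Order.IsAtomicBAOrder _≤₂_ z₂) where
  private
    module O₁ = Order.IsAtomicBAOrder ba₁
    module O₂ = Order.IsAtomicBAOrder ba₂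
    open Order using (IsAtom)
    _≤_ = Pointwise _≤₁_ _≤₂_

  IsAtom-Pointwise : (a : A) (b : B) →
    IsAtom _≤_ (z₁ , z₂) (a , b) ⇔ ((IsAtom _≤₁_ z₁ a × b ≡ z₂) ⊎ (a ≡ z₁ × IsAtom _≤₂_ z₂ b))
  IsAtom-Pointwise a b = mk⇔ split-atom (λ { (inj₁ (atom , refl)) → left-atom atom
                                                ; (inj₂ (refl , atom)) → right-atom atom })
    where
      left-atom : IsAtom _≤₁_ z₁ a → IsAtom _≤_ (z₁ , z₂) (a , z₂)
      left-atom (a≢z , below-a) =
        (a≢z ∘ cong proj₁) ,
        λ { (c , d) (c≤a , d≤z) → let d≡z = O₂.antisym d z₂ d≤z (O₂.least d) in
            [ (λ c≡z → inj₁ (×-≡,≡→≡ (c≡z , d≡z))) , (λ c≡a → inj₂ (×-≡,≡→≡ (c≡a , d≡z))) ]′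
              (below-a c c≤a) }

      right-atom : IsAtom _≤₂_ z₂ b → IsAtom _≤_ (z₁ , z₂) (z₁ , b)
      right-atom (b≢z , below-b) =
        (b≢z ∘ cong proj₂) ,
        λ { (c , d) (c≤z , d≤b) → let c≡z = O₁.antisym c z₁ c≤z (O₁.least c) in
            [ (λ d≡z → inj₁ (×-≡,≡→≡ (c≡z , d≡z))) , (λ d≡b → inj₂ (×-≡,≡→≡ (c≡z , d≡b))) ]′
              (below-b d d≤b) }

      split-atom : IsAtom _≤_ (z₁ , z₂) (a , b) →
        (IsAtom _≤₁_ z₁ a × b ≡ z₂) ⊎ (a ≡ z₁ × IsAtom _≤₂_ z₂ b)
      split-atom (ab≢z , below-ab) with em {a ≡ z₁}
      ... | yes a≡z =
        inj₂ (a≡z , (λ b≡z → ab≢z (×-≡,≡→≡ (a≡z , b≡z))) ,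
                    λ d d≤b → [ inj₁ ∘ cong proj₂ , inj₂ ∘ cong proj₂ ]′
                                (below-ab (z₁ , d) (O₁.least a , d≤b)))
      ... | no a≢z =
        inj₁ ((a≢z , λ c c≤a → [ inj₁ ∘ cong proj₁ , inj₂ ∘ cong proj₁ ]′
                                  (below-ab (c , z₂) (c≤a , O₂.least b))) ,
              [ (λ az≡z → contradiction (cong proj₁ az≡z) a≢z) , (λ az≡ab → sym (cong proj₂ az≡ab)) ]′
                (below-ab (a , z₂) (O₁.refl≤ a , O₂.least b)))

evalT-cong : (K : Structure) {ρ ρ' : Fin n → Structure.Carrier K} →
             ρ ≗ ρ' → (t : Term n) → evalT K ρ t ≡ evalT K ρ' t
evalT-cong K eq (var i) = eq i
evalT-cong K eq bot = refl

extend-cong : (a : A) {ρ ρ' : Fin n → A} → ρ ≗ ρ' → extend a ρ ≗ extend a ρ'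
extend-cong a eq zero = refl
extend-cong a eq (suc i) = eq i

Sat-cong : (K : Structure) (φ : Formula n) {ρ ρ' : Fin n → Structure.Carrier K} →
           ρ ≗ ρ' → Sat K φ ρ ⇔ Sat K φ ρ'
Sat-cong K (s ≐ t) eq = ≡⇒⇔ (cong₂ _≡_ (evalT-cong K eq s) (evalT-cong K eq t))
Sat-cong K (s ⊑ t) eq = ≡⇒⇔ (cong₂ (Structure._⊆_ K) (evalT-cong K eq s) (evalT-cong K eq t))
Sat-cong K (s ◃ t) eq = ≡⇒⇔ (cong₂ (Structure._◁_ K) (evalT-cong K eq s) (evalT-cong K eq t))
Sat-cong K (at t) eq = ≡⇒⇔ (cong (Structure.At K) (evalT-cong K eq t))
Sat-cong K falsum eq = ⇔-id _
Sat-cong K (φ ⇒ ψ) eq = →-cong-⇔ (Sat-cong K φ eq) (Sat-cong K ψ eq)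
Sat-cong K (φ ∧ ψ) eq = Sat-cong K φ eq ×-⇔ Sat-cong K ψ eq
Sat-cong K (φ ∨ ψ) eq = Sat-cong K φ eq ⊎-⇔ Sat-cong K ψ eq
Sat-cong K (¬' φ) eq = ¬-cong-⇔ (Sat-cong K φ eq)
Sat-cong K (all φ) eq = Π-cong-⇔ (λ a → Sat-cong K φ (extend-cong a eq))
Sat-cong K (ex φ) eq = Σ.congˡ (Sat-cong K φ (extend-cong _ eq))

extend-<,> : (a : A) (b : B) (ρ₁ : Fin n → A) (ρ₂ : Fin n → B) →
             extend (a , b) < ρ₁ , ρ₂ > ≗ < extend a ρ₁ , extend b ρ₂ >
extend-<,> a b ρ₁ ρ₂ zero = refl
extend-<,> a b ρ₁ ρ₂ (suc i) = refl

-- The pair (ψ , χ) stands for ψ read in the first summand and χ in the second;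
-- a list of pairs stands for their disjunction.
Decomposition : ℕ → Set
Decomposition n = List (Formula n × Formula n)

⊤ᶠ : Formula n
⊤ᶠ = ¬' falsum

_∧ᴰ_ : Decomposition n → Decomposition n → Decomposition n
_∧ᴰ_ = cartesianProductWith (λ (ψ , χ) (ψ' , χ') → (ψ ∧ ψ' , χ ∧ χ'))

¬ᴰ_ : Decomposition n → Decomposition n
¬ᴰ [] = [ ⊤ᶠ , ⊤ᶠ ]
¬ᴰ ((ψ , χ) ∷ D) = ((¬' ψ , ⊤ᶠ) ∷ [ ⊤ᶠ , ¬' χ ]) ∧ᴰ (¬ᴰ D)

∃ᴰ_ : Decomposition (suc n) → Decomposition n
∃ᴰ_ = map (λ (ψ , χ) → (ex ψ , ex χ))

_⇒ᴰ_ : Decomposition n → Decomposition n → Decomposition n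
D ⇒ᴰ E = (¬ᴰ D) ++ E

∀ᴰ_ : Decomposition (suc n) → Decomposition n
∀ᴰ D = ¬ᴰ ∃ᴰ ¬ᴰ D

decompose : Formula n → Decomposition n
decompose (s ≐ t) = [ s ≐ t , s ≐ t ]
decompose (s ⊑ t) = [ s ⊑ t , s ⊑ t ]
decompose (s ◃ t) = (¬' (s ≐ bot) , ¬' (t ≐ bot)) ∷ (s ◃ t , ⊤ᶠ) ∷ [ ⊤ᶠ , s ◃ t ]
decompose (at t) = (at t , t ≐ bot) ∷ [ t ≐ bot , at t ]
decompose falsum = []
decompose (φ ⇒ ψ) = decompose φ ⇒ᴰ decompose ψ
decompose (φ ∧ ψ) = decompose φ ∧ᴰ decompose ψ
decompose (φ ∨ ψ) = decompose φ ++ decompose ψ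
decompose (¬' φ) = ¬ᴰ decompose φ
decompose (all φ) = ∀ᴰ decompose φ
decompose (ex φ) = ∃ᴰ decompose φ

module Semantics (M N : Structure) where
  private
    module M = Structure M
    module N = Structure N

  Holds : Formula n × Formula n → (Fin n → M.Carrier) → (Fin n → N.Carrier) → Set
  Holds (ψ , χ) ρ₁ ρ₂ = Sat M ψ ρ₁ × Sat N χ ρ₂

  ⟦_⟧ : Decomposition n → (Fin n → M.Carrier) → (Fin n → N.Carrier) → Set
  ⟦ D ⟧ ρ₁ ρ₂ = Any (λ p → Holds p ρ₁ ρ₂) D

  module _ (ρ₁ : Fin n → M.Carrier) (ρ₂ : Fin n → N.Carrier) where

    evalT-⊕ : (t : Term n) → evalT (M ⊕ N) < ρ₁ , ρ₂ > t ≡ (evalT M ρ₁ t , evalT N ρ₂ t)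
    evalT-⊕ (var i) = refl
    evalT-⊕ bot = refl

    evalT-⊕-resp₂ : (R : M.Carrier × N.Carrier → M.Carrier × N.Carrier → Set) (s t : Term n) →
      R (evalT (M ⊕ N) < ρ₁ , ρ₂ > s) (evalT (M ⊕ N) < ρ₁ , ρ₂ > t) ⇔
      R (evalT M ρ₁ s , evalT N ρ₂ s) (evalT M ρ₁ t , evalT N ρ₂ t)
    evalT-⊕-resp₂ R s t = ≡⇒⇔ (cong₂ R (evalT-⊕ s) (evalT-⊕ t))

    ⟦singleton⟧ : (p : Formula n × Formula n) → ⟦ [ p ] ⟧ ρ₁ ρ₂ ⇔ Holds p ρ₁ ρ₂
    ⟦singleton⟧ p = mk⇔ singleton⁻ singleton⁺

    ⟦∷⟧ : (p : Formula n × Formula n) (D : Decomposition n) →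
          ⟦ p ∷ D ⟧ ρ₁ ρ₂ ⇔ (Holds p ρ₁ ρ₂ ⊎ ⟦ D ⟧ ρ₁ ρ₂)
    ⟦∷⟧ p D = ⇔-sym (↔⇒⇔ (∷↔ _))

    ⟦++⟧ : (D E : Decomposition n) → ⟦ D ++ E ⟧ ρ₁ ρ₂ ⇔ (⟦ D ⟧ ρ₁ ρ₂ ⊎ ⟦ E ⟧ ρ₁ ρ₂)
    ⟦++⟧ D E = ⇔-sym (↔⇒⇔ ++↔)

    ⟦∧ᴰ⟧ : (D E : Decomposition n) → ⟦ D ∧ᴰ E ⟧ ρ₁ ρ₂ ⇔ (⟦ D ⟧ ρ₁ ρ₂ × ⟦ E ⟧ ρ₁ ρ₂)
    ⟦∧ᴰ⟧ D E = mk⇔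
      (cartesianProductWith⁻ _ (λ ((a , c) , (b , d)) → (a , b) , (c , d)) D E)
      (uncurry (cartesianProductWith⁺ _ (λ (a , b) (c , d) → (a , c) , (b , d))))

    ⟦¬ᴰ⟧ : ExcludedMiddle 0ℓ → (D : Decomposition n) → ⟦ ¬ᴰ D ⟧ ρ₁ ρ₂ ⇔ (¬ ⟦ D ⟧ ρ₁ ρ₂)
    ⟦¬ᴰ⟧ em [] = mk⇔ (λ _ ()) (λ _ → here ((λ ()) , (λ ())))
    ⟦¬ᴰ⟧ em ((ψ , χ) ∷ D) = begin
      ⟦ ((¬' ψ , ⊤ᶠ) ∷ [ ⊤ᶠ , ¬' χ ]) ∧ᴰ (¬ᴰ D) ⟧ ρ₁ ρ₂
        ≈⟨ ⟦∧ᴰ⟧ _ (¬ᴰ D) ⟩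
      (⟦ (¬' ψ , ⊤ᶠ) ∷ [ ⊤ᶠ , ¬' χ ] ⟧ ρ₁ ρ₂ × ⟦ ¬ᴰ D ⟧ ρ₁ ρ₂)
        ≈⟨ ⟦¬ψ∨¬χ⟧ ×-⇔ ⟦¬ᴰ⟧ em D ⟩
      (¬ Holds (ψ , χ) ρ₁ ρ₂ × ¬ ⟦ D ⟧ ρ₁ ρ₂)
        ≈⟨ ¬⊎⇔¬×¬ ⟨
      ¬ (Holds (ψ , χ) ρ₁ ρ₂ ⊎ ⟦ D ⟧ ρ₁ ρ₂)
        ≈⟨ ¬-cong-⇔ (⟦∷⟧ (ψ , χ) D) ⟨
      (¬ ⟦ (ψ , χ) ∷ D ⟧ ρ₁ ρ₂) ∎
      where
        open Classical em
        ⟦¬ψ∨¬χ⟧ : ⟦ (¬' ψ , ⊤ᶠ) ∷ [ ⊤ᶠ , ¬' χ ] ⟧ ρ₁ ρ₂ ⇔ (¬ Holds (ψ , χ) ρ₁ ρ₂)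
        ⟦¬ψ∨¬χ⟧ = begin
          ⟦ (¬' ψ , ⊤ᶠ) ∷ [ ⊤ᶠ , ¬' χ ] ⟧ ρ₁ ρ₂
            ≈⟨ ⟦∷⟧ _ _ ⟩
          (Holds (¬' ψ , ⊤ᶠ) ρ₁ ρ₂ ⊎ ⟦ [ ⊤ᶠ , ¬' χ ] ⟧ ρ₁ ρ₂)
            ≈⟨ ×-¬⊥ʳ ⊎-⇔ (×-¬⊥ˡ ⇔-∘ ⟦singleton⟧ _) ⟩
          (¬ Sat M ψ ρ₁ ⊎ ¬ Sat N χ ρ₂)
            ≈⟨ ¬×⇔¬⊎¬ ⟨
          (¬ Holds (ψ , χ) ρ₁ ρ₂) ∎

    ⟦⇒ᴰ⟧ : ExcludedMiddle 0ℓ → (D E : Decomposition n) →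
           ⟦ D ⇒ᴰ E ⟧ ρ₁ ρ₂ ⇔ (⟦ D ⟧ ρ₁ ρ₂ → ⟦ E ⟧ ρ₁ ρ₂)
    ⟦⇒ᴰ⟧ em D E = begin
      ⟦ D ⇒ᴰ E ⟧ ρ₁ ρ₂                     ≈⟨ ⟦++⟧ (¬ᴰ D) E ⟩
      (⟦ ¬ᴰ D ⟧ ρ₁ ρ₂ ⊎ ⟦ E ⟧ ρ₁ ρ₂)        ≈⟨ ⟦¬ᴰ⟧ em D ⊎-⇔ ⇔-id _ ⟩
      (¬ ⟦ D ⟧ ρ₁ ρ₂ ⊎ ⟦ E ⟧ ρ₁ ρ₂)         ≈⟨ Classical.→⇔¬⊎ em ⟨
      (⟦ D ⟧ ρ₁ ρ₂ → ⟦ E ⟧ ρ₁ ρ₂)           ∎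

  ⟦∃ᴰ⟧ : (ρ₁ : Fin n → M.Carrier) (ρ₂ : Fin n → N.Carrier) (D : Decomposition (suc n)) →
         ⟦ ∃ᴰ D ⟧ ρ₁ ρ₂ ⇔ Σ (M.Carrier × N.Carrier) (λ (a , b) → ⟦ D ⟧ (extend a ρ₁) (extend b ρ₂))
  ⟦∃ᴰ⟧ ρ₁ ρ₂ D = mk⇔ (Any-Σ⁻ʳ ∘ Any.map (to Σ×Σ⇔Σ×) ∘ map⁻)
                     (map⁺ ∘ Any.map (from Σ×Σ⇔Σ×) ∘ Any-Σ⁺ʳ)

  ⟦∀ᴰ⟧ : (ρ₁ : Fin n → M.Carrier) (ρ₂ : Fin n → N.Carrier) → ExcludedMiddle 0ℓ →
         (D : Decomposition (suc n)) →
         ⟦ ∀ᴰ D ⟧ ρ₁ ρ₂ ⇔ ((p : M.Carrier × N.Carrier) → ⟦ D ⟧ (extend (proj₁ p) ρ₁) (extend (proj₂ p) ρ₂))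
  ⟦∀ᴰ⟧ ρ₁ ρ₂ em D = begin
    ⟦ ¬ᴰ ∃ᴰ ¬ᴰ D ⟧ ρ₁ ρ₂
      ≈⟨ ⟦¬ᴰ⟧ ρ₁ ρ₂ em (∃ᴰ ¬ᴰ D) ⟩
    (¬ ⟦ ∃ᴰ ¬ᴰ D ⟧ ρ₁ ρ₂)
      ≈⟨ ¬-cong-⇔ (⟦∃ᴰ⟧ ρ₁ ρ₂ (¬ᴰ D)) ⟩
    (¬ Σ (M.Carrier × N.Carrier) λ (a , b) → ⟦ ¬ᴰ D ⟧ (extend a ρ₁) (extend b ρ₂))
      ≈⟨ ¬-cong-⇔ (Σ.congˡ (⟦¬ᴰ⟧ _ _ em D)) ⟩
    (¬ Σ (M.Carrier × N.Carrier) λ (a , b) → ¬ ⟦ D ⟧ (extend a ρ₁) (extend b ρ₂))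
      ≈⟨ Classical.Π⇔¬Σ¬ em ⟨
    ((p : M.Carrier × N.Carrier) → ⟦ D ⟧ (extend (proj₁ p) ρ₁) (extend (proj₂ p) ρ₂)) ∎

⟦⟧-resp-≡ₑ : {M₁ M₂ N₁ N₂ : Structure} → M₁ ≡ₑ N₁ → M₂ ≡ₑ N₂ → (D : Decomposition 0) →
             Semantics.⟦_⟧ M₁ M₂ D noVars noVars ⇔ Semantics.⟦_⟧ N₁ N₂ D noVars noVars
⟦⟧-resp-≡ₑ e₁ e₂ D = mk⇔ (Any.map λ { {ψ , χ} (h₁ , h₂) → proj₁ (e₁ ψ) h₁ , proj₁ (e₂ χ) h₂ })
                         (Any.map λ { {ψ , χ} (h₁ , h₂) → proj₂ (e₁ ψ) h₁ , proj₂ (e₂ χ) h₂ })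

module ⊕-Decomposition (em : ExcludedMiddle 0ℓ) {M N : Structure} (bM : IsBase M) (bN : IsBase N) where
  private
    module M = Structure M
    module N = Structure N
    module BM = IsBase bM
    module BN = IsBase bN
  open Semantics M N

  At-⊕ : (a : M.Carrier) (b : N.Carrier) →
         Structure.At (M ⊕ N) (a , b) ⇔ ((M.At a × b ≡ N.⊥ₛ) ⊎ (a ≡ M.⊥ₛ × N.At b))
  At-⊕ a b = begin
    Structure.At (M ⊕ N) (a , b)
      ≈⟨ IsAtom-Pointwise em BM.ba BN.ba a b ⟩
    ((Order.IsAtom M._⊆_ M.⊥ₛ a × b ≡ N.⊥ₛ) ⊎ (a ≡ M.⊥ₛ × Order.IsAtom N._⊆_ N.⊥ₛ b))
      ≈⟨ (fromIff (BM.at-atoms a) ×-⇔ ⇔-id _) ⊎-⇔ (⇔-id _ ×-⇔ fromIff (BN.at-atoms b)) ⟨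
    ((M.At a × b ≡ N.⊥ₛ) ⊎ (a ≡ M.⊥ₛ × N.At b)) ∎

  module _ {n : ℕ} (ρ₁ : Fin n → M.Carrier) (ρ₂ : Fin n → N.Carrier) where

    decompose-correct-≐ : (s t : Term n) → Sat (M ⊕ N) (s ≐ t) < ρ₁ , ρ₂ > ⇔ ⟦ decompose (s ≐ t) ⟧ ρ₁ ρ₂
    decompose-correct-≐ s t = begin
      Sat (M ⊕ N) (s ≐ t) < ρ₁ , ρ₂ >
        ≈⟨ evalT-⊕-resp₂ ρ₁ ρ₂ _≡_ s t ⟩
      ((evalT M ρ₁ s , evalT N ρ₂ s) ≡ (evalT M ρ₁ t , evalT N ρ₂ t))
        ≈⟨ mk⇔ ×-≡,≡←≡ ×-≡,≡→≡ ⟩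
      Holds (s ≐ t , s ≐ t) ρ₁ ρ₂
        ≈⟨ ⟦singleton⟧ ρ₁ ρ₂ _ ⟨
      ⟦ decompose (s ≐ t) ⟧ ρ₁ ρ₂ ∎

    decompose-correct-◃ : (s t : Term n) → Sat (M ⊕ N) (s ◃ t) < ρ₁ , ρ₂ > ⇔ ⟦ decompose (s ◃ t) ⟧ ρ₁ ρ₂
    decompose-correct-◃ s t = begin
      Sat (M ⊕ N) (s ◃ t) < ρ₁ , ρ₂ >
        ≈⟨ evalT-⊕-resp₂ ρ₁ ρ₂ (Structure._◁_ (M ⊕ N)) s t ⟩
      (Holds (¬' (s ≐ bot) , ¬' (t ≐ bot)) ρ₁ ρ₂ ⊎ Sat M (s ◃ t) ρ₁ ⊎ Sat N (s ◃ t) ρ₂)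
        ≈⟨ ⇔-id _ ⊎-⇔ ×-¬⊥ʳ ⊎-⇔ ×-¬⊥ˡ ⟨
      (Holds (¬' (s ≐ bot) , ¬' (t ≐ bot)) ρ₁ ρ₂ ⊎ Holds (s ◃ t , ⊤ᶠ) ρ₁ ρ₂ ⊎ Holds (⊤ᶠ , s ◃ t) ρ₁ ρ₂)
        ≈⟨ ⇔-id _ ⊎-⇔ ⇔-id _ ⊎-⇔ ⟦singleton⟧ ρ₁ ρ₂ _ ⟨
      (Holds (¬' (s ≐ bot) , ¬' (t ≐ bot)) ρ₁ ρ₂ ⊎ Holds (s ◃ t , ⊤ᶠ) ρ₁ ρ₂ ⊎ ⟦ [ ⊤ᶠ , s ◃ t ] ⟧ ρ₁ ρ₂)
        ≈⟨ ⇔-id _ ⊎-⇔ ⟦∷⟧ ρ₁ ρ₂ _ _ ⟨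
      (Holds (¬' (s ≐ bot) , ¬' (t ≐ bot)) ρ₁ ρ₂ ⊎ ⟦ (s ◃ t , ⊤ᶠ) ∷ [ ⊤ᶠ , s ◃ t ] ⟧ ρ₁ ρ₂)
        ≈⟨ ⟦∷⟧ ρ₁ ρ₂ _ _ ⟨
      ⟦ decompose (s ◃ t) ⟧ ρ₁ ρ₂ ∎

    decompose-correct-at : (t : Term n) → Sat (M ⊕ N) (at t) < ρ₁ , ρ₂ > ⇔ ⟦ decompose (at t) ⟧ ρ₁ ρ₂
    decompose-correct-at t = begin
      Sat (M ⊕ N) (at t) < ρ₁ , ρ₂ >
        ≈⟨ ≡⇒⇔ (cong (Structure.At (M ⊕ N)) (evalT-⊕ ρ₁ ρ₂ t)) ⟩
      Structure.At (M ⊕ N) (evalT M ρ₁ t , evalT N ρ₂ t)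
        ≈⟨ At-⊕ _ _ ⟩
      (Holds (at t , t ≐ bot) ρ₁ ρ₂ ⊎ Holds (t ≐ bot , at t) ρ₁ ρ₂)
        ≈⟨ ⇔-id _ ⊎-⇔ ⟦singleton⟧ ρ₁ ρ₂ _ ⟨
      (Holds (at t , t ≐ bot) ρ₁ ρ₂ ⊎ ⟦ [ t ≐ bot , at t ] ⟧ ρ₁ ρ₂)
        ≈⟨ ⟦∷⟧ ρ₁ ρ₂ _ _ ⟨
      ⟦ decompose (at t) ⟧ ρ₁ ρ₂ ∎

  decompose-correct : {n : ℕ} (φ : Formula n) (ρ₁ : Fin n → M.Carrier) (ρ₂ : Fin n → N.Carrier) →
                      Sat (M ⊕ N) φ < ρ₁ , ρ₂ > ⇔ ⟦ decompose φ ⟧ ρ₁ ρ₂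
  decompose-correct-extend : {n : ℕ} (φ : Formula (suc n))
    (ρ₁ : Fin n → M.Carrier) (ρ₂ : Fin n → N.Carrier) (p : M.Carrier × N.Carrier) →
    Sat (M ⊕ N) φ (extend p < ρ₁ , ρ₂ >) ⇔ ⟦ decompose φ ⟧ (extend (proj₁ p) ρ₁) (extend (proj₂ p) ρ₂)

  decompose-correct (s ≐ t) ρ₁ ρ₂ = decompose-correct-≐ ρ₁ ρ₂ s t
  decompose-correct (s ⊑ t) ρ₁ ρ₂ =
    ⇔-sym (⟦singleton⟧ ρ₁ ρ₂ _) ⇔-∘ evalT-⊕-resp₂ ρ₁ ρ₂ (Structure._⊆_ (M ⊕ N)) s t
  decompose-correct (s ◃ t) ρ₁ ρ₂ = decompose-correct-◃ ρ₁ ρ₂ s t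
  decompose-correct (at t) ρ₁ ρ₂ = decompose-correct-at ρ₁ ρ₂ t
  decompose-correct falsum ρ₁ ρ₂ = mk⇔ (λ ()) (λ ())
  decompose-correct (φ ⇒ ψ) ρ₁ ρ₂ =
    ⇔-sym (⟦⇒ᴰ⟧ ρ₁ ρ₂ em (decompose φ) (decompose ψ)) ⇔-∘
    →-cong-⇔ (decompose-correct φ ρ₁ ρ₂) (decompose-correct ψ ρ₁ ρ₂)
  decompose-correct (φ ∧ ψ) ρ₁ ρ₂ =
    ⇔-sym (⟦∧ᴰ⟧ ρ₁ ρ₂ (decompose φ) (decompose ψ)) ⇔-∘
    (decompose-correct φ ρ₁ ρ₂ ×-⇔ decompose-correct ψ ρ₁ ρ₂)
  decompose-correct (φ ∨ ψ) ρ₁ ρ₂ =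
    ⇔-sym (⟦++⟧ ρ₁ ρ₂ (decompose φ) (decompose ψ)) ⇔-∘
    (decompose-correct φ ρ₁ ρ₂ ⊎-⇔ decompose-correct ψ ρ₁ ρ₂)
  decompose-correct (¬' φ) ρ₁ ρ₂ =
    ⇔-sym (⟦¬ᴰ⟧ ρ₁ ρ₂ em (decompose φ)) ⇔-∘ ¬-cong-⇔ (decompose-correct φ ρ₁ ρ₂)
  decompose-correct (all φ) ρ₁ ρ₂ =
    ⇔-sym (⟦∀ᴰ⟧ ρ₁ ρ₂ em (decompose φ)) ⇔-∘ Π-cong-⇔ (decompose-correct-extend φ ρ₁ ρ₂)
  decompose-correct (ex φ) ρ₁ ρ₂ =
    ⇔-sym (⟦∃ᴰ⟧ ρ₁ ρ₂ (decompose φ)) ⇔-∘ Σ.congˡ (decompose-correct-extend φ ρ₁ ρ₂ _)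

  decompose-correct-extend φ ρ₁ ρ₂ (a , b) =
    decompose-correct φ (extend a ρ₁) (extend b ρ₂) ⇔-∘ Sat-cong (M ⊕ N) φ (extend-<,> a b ρ₁ ρ₂)

  ⊕-⊨⇔⟦decompose⟧ : (φ : Sentence) → (M ⊕ N) ⊨ φ ⇔ ⟦ decompose φ ⟧ noVars noVars
  ⊕-⊨⇔⟦decompose⟧ φ = decompose-correct φ noVars noVars ⇔-∘ Sat-cong (M ⊕ N) φ (λ ())

corollary2p24 : ExcludedMiddle 0ℓ →
    (M₁ M₂ N₁ N₂ : Structure) →
    IsBase M₁ → IsBase M₂ → IsBase N₁ → IsBase N₂ →
    M₁ ≡ₑ N₁ → M₂ ≡ₑ N₂ → (M₁ ⊕ M₂) ≡ₑ (N₁ ⊕ N₂)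
corollary2p24 em M₁ M₂ N₁ N₂ bM₁ bM₂ bN₁ bN₂ M₁≡N₁ M₂≡N₂ φ = toIff (begin
  (M₁ ⊕ M₂) ⊨ φ
    ≈⟨ ⊕-Decomposition.⊕-⊨⇔⟦decompose⟧ em bM₁ bM₂ φ ⟩
  Semantics.⟦_⟧ M₁ M₂ (decompose φ) noVars noVars
    ≈⟨ ⟦⟧-resp-≡ₑ M₁≡N₁ M₂≡N₂ (decompose φ) ⟩
  Semantics.⟦_⟧ N₁ N₂ (decompose φ) noVars noVars
    ≈⟨ ⊕-Decomposition.⊕-⊨⇔⟦decompose⟧ em bN₁ bN₂ φ ⟨
  (N₁ ⊕ N₂) ⊨ φ ∎)
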